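{- Every graph $G$ with an odd number of vertices and $\alpha(G)=2$ is equimatchable and claw-free.
   Context: $\alpha(G)$ is the independence number. A graph is equimatchable if all its maximal matchings have the same cardinality; claw-free if it has no induced $K_{1,3}$. -}

module Defs where

open import Level using (Level; suc; _⊔_)
open import Data.Nat using (ℕ; _≤_; _%_)
open import Data.Fin using (Fin)
open import Data.List using (List; []; _∷_; length; concatMap)
open import Data.List.Membership.Propositional using (_∈_)
open import Data.List.Relation.Unary.Unique.Propositional using (Unique)
open import Data.List.Relation.Unary.AllPairs using (AllPairs)
open import Data.Product using (Σ; ∃; _×_; _,_; proj₁)
open import Data.Sum using (_⊎_)
open import Relation.Nullary using (¬_; Dec)
open import Relation.Binary.PropositionalEquality using (_≡_)

record Graph (n : ℕ) : Set₁ where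
  field
    Adj    : Fin n → Fin n → Set
    sym    : ∀ {u v} → Adj u v → Adj v u
    irrefl : ∀ {u} → ¬ Adj u u
    adj?   : ∀ u v → Dec (Adj u v)

module _ {n : ℕ} (G : Graph n) where
  open Graph G

  IsIndependent : List (Fin n) → Set
  IsIndependent S = Unique S × AllPairs (λ u v → ¬ Adj u v) S

  IndependenceNumber : ℕ → Set
  IndependenceNumber k =
    (∃ λ S → IsIndependent S × length S ≡ k) ×
    (∀ S → IsIndependent S → length S ≤ k)

  -- an edge is an ordered pair of adjacent vertices (representing {u,v})
  Edge : Set
  Edge = Σ (Fin n × Fin n) (λ p → Adj (proj₁ p) (Data.Product.proj₂ p))

  endpoints : List Edge → List (Fin n)
  endpoints = concatMap (λ { ((u , v) , _) → u ∷ v ∷ [] })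

  -- a matching: a list of edges whose endpoints are all distinct
  -- (so the edges are pairwise disjoint, and its cardinality is its length)
  IsMatching : List Edge → Set
  IsMatching M = Unique (endpoints M)

  -- maximal matching: no edge of G can be added, i.e. every edge of G
  -- has an endpoint covered by M
  IsMaximalMatching : List Edge → Set
  IsMaximalMatching M =
    IsMatching M ×
    (∀ u v → Adj u v → u ∈ endpoints M ⊎ v ∈ endpoints M)

  Equimatchable : Set
  Equimatchable =
    ∀ M M′ → IsMaximalMatching M → IsMaximalMatching M′ → length M ≡ length M′

  ClawFree : Set
  ClawFree =
    ∀ c a b d → Adj c a → Adj c b → Adj c d →
    ¬ a ≡ b → ¬ a ≡ d → ¬ b ≡ d →
    ¬ ((¬ Adj a b) × (¬ Adj a d) × (¬ Adj b d))

-- Let M be a maximal matching. By maximality no edge joins two unmatched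
-- vertices, so the unmatched vertices form an independent set and number at
-- most α(G) = 2. They number n − 2|M|, which is odd, hence exactly one vertex
-- is unmatched and |M| = (n − 1)/2 for every maximal matching. A claw would
-- contain three pairwise non-adjacent leaves, an independent set of size 3.
module Submission where

open import Defs
open import Data.Nat using (ℕ; suc; _+_; _*_; _%_; _≤_; s≤s)
open import Data.Nat.Properties using (+-comm; *-comm; *-suc; +-cancelʳ-≡; *-cancelˡ-≡)
open import Data.Nat.DivMod using ([m+kn]%n≡m%n)
open import Data.Empty using (⊥)
open import Data.Product using (_×_; _,_; proj₂)
open import Data.Sum using ([_,_]′)
open import Data.Fin using (Fin)
open import Data.Fin.Properties using (_≟_)
open import Data.List using (List; []; _∷_; length; _++_; filter; allFin)
open import Data.List.Properties using (length-++; length-tabulate)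
open import Data.List.Membership.Propositional using (_∈_; _∉_)
open import Data.List.Membership.Propositional.Properties using (∈-allFin; ∈-++⁺ˡ; ∈-++⁺ʳ; ∈-filter⁺)
open import Data.List.Membership.Propositional.Properties.WithK using (unique∧set⇒bag)
import Data.List.Membership.DecPropositional as DecMembership
open import Data.List.Relation.Binary.BagAndSetEquality using (∼bag⇒↭)
open import Data.List.Relation.Binary.Permutation.Propositional.Properties using (↭-length)
open import Data.List.Relation.Unary.All as All using (All; []; _∷_)
open import Data.List.Relation.Unary.All.Properties using (all-filter)
open import Data.List.Relation.Unary.AllPairs using (AllPairs; []; _∷_)
open import Data.List.Relation.Unary.Unique.Propositional using (Unique)
open import Data.List.Relation.Unary.Unique.Propositional.Properties using (allFin⁺; filter⁺; ++⁺)
open import Function.Bundles using (_⇔_; mk⇔)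
open import Relation.Nullary using (Dec; ¬?; yes; no)
open import Relation.Binary.PropositionalEquality using (_≡_; refl; sym; trans; cong; subst; module ≡-Reasoning)

module _ {A : Set} where

  length-unique-⇔ : ∀ {xs ys : List A} → Unique xs → Unique ys →
                    (∀ {z} → z ∈ xs ⇔ z ∈ ys) → length xs ≡ length ys
  length-unique-⇔ uxs uys xs⇔ys = ↭-length (∼bag⇒↭ (unique∧set⇒bag uxs uys xs⇔ys))

  All⇒AllPairs : ∀ {P : A → Set} {R : A → A → Set} → (∀ {x y} → P x → P y → R x y) →
                 ∀ {xs} → All P xs → AllPairs R xs
  All⇒AllPairs r []         = []
  All⇒AllPairs r (px ∷ pxs) = All.map (r px) pxs ∷ All⇒AllPairs r pxs

[2m+u]%2≡u%2 : ∀ m u → (2 * m + u) % 2 ≡ u % 2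
[2m+u]%2≡u%2 m u rewrite +-comm (2 * m) u | *-comm 2 m = [m+kn]%n≡m%n u m 2

odd-remainder≤2 : ∀ m u → (2 * m + u) % 2 ≡ 1 → u ≤ 2 → u ≡ 1
odd-remainder≤2 m u odd u≤2 = small-odd u (trans (sym ([2m+u]%2≡u%2 m u)) odd) u≤2
  where
  small-odd : ∀ u → u % 2 ≡ 1 → u ≤ 2 → u ≡ 1
  small-odd 0 () _
  small-odd 1 _ _ = refl
  small-odd 2 () _
  small-odd (suc (suc (suc _))) _ (s≤s (s≤s ()))

module _ {n : ℕ} (G : Graph n) where
  open DecMembership (_≟_ {n}) using (_∈?_)

  IndependenceAtMost : ℕ → Set
  IndependenceAtMost k = ∀ S → IsIndependent G S → length S ≤ k

  unmatched? : ∀ M v → Dec (v ∉ endpoints G M)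
  unmatched? M v = ¬? (v ∈? endpoints G M)

  unmatched : List (Edge G) → List (Fin n)
  unmatched M = filter (unmatched? M) (allFin n)

  unique-unmatched : ∀ M → Unique (unmatched M)
  unique-unmatched M = filter⁺ (unmatched? M) (allFin⁺ n)

  all-unmatched : ∀ M → All (_∉ endpoints G M) (unmatched M)
  all-unmatched M = all-filter (unmatched? M) (allFin n)

  length-endpoints : ∀ M → length (endpoints G M) ≡ 2 * length M
  length-endpoints []      = refl
  length-endpoints (_ ∷ M) = trans (cong (2 +_) (length-endpoints M)) (sym (*-suc 2 (length M)))

  vertex-count : ∀ M → IsMatching G M → n ≡ 2 * length M + length (unmatched M)
  vertex-count M uM = begin
    n                                   ≡⟨ sym (length-tabulate (λ i → i)) ⟩
    length (allFin n)                   ≡⟨ length-unique-⇔ (allFin⁺ n) (++⁺ uM (unique-unmatched M) disjoint)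
                                                           (mk⇔ split (λ _ → ∈-allFin _)) ⟩
    length (E ++ unmatched M)           ≡⟨ length-++ E ⟩
    length E + length (unmatched M)     ≡⟨ cong (_+ length (unmatched M)) (length-endpoints M) ⟩
    2 * length M + length (unmatched M) ∎
    where
    open ≡-Reasoning
    E : List (Fin n)
    E = endpoints G M
    disjoint : ∀ {z} → z ∈ E × z ∈ unmatched M → ⊥
    disjoint (z∈E , z∈U) = All.lookup (all-unmatched M) z∈U z∈E
    split : ∀ {z} → z ∈ allFin n → z ∈ E ++ unmatched M
    split {z} z∈V with z ∈? E
    ... | yes z∈E = ∈-++⁺ˡ z∈E
    ... | no  z∉E = ∈-++⁺ʳ E (∈-filter⁺ (unmatched? M) z∈V z∉E)

  unmatched-independent : ∀ M → IsMaximalMatching G M → IsIndependent G (unmatched M)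
  unmatched-independent M (_ , cover) =
    unique-unmatched M ,
    All⇒AllPairs (λ x∉E y∉E xy → [ x∉E , y∉E ]′ (cover _ _ xy)) (all-unmatched M)

  maximal-matching-size : n % 2 ≡ 1 → IndependenceAtMost 2 →
                          ∀ M → IsMaximalMatching G M → n ≡ 2 * length M + 1
  maximal-matching-size odd α≤2 M maximal@(uM , _) =
    trans count (cong (2 * length M +_) one-unmatched)
    where
    count : n ≡ 2 * length M + length (unmatched M)
    count = vertex-count M uM
    one-unmatched : length (unmatched M) ≡ 1
    one-unmatched = odd-remainder≤2 (length M) _ (subst (λ k → k % 2 ≡ 1) count odd)
                      (α≤2 _ (unmatched-independent M maximal))

  equimatchable : n % 2 ≡ 1 → IndependenceAtMost 2 → Equimatchable G
  equimatchable odd α≤2 M M′ maximal maximal′ =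
    *-cancelˡ-≡ _ _ 2 (+-cancelʳ-≡ 1 _ _
      (trans (sym (maximal-matching-size odd α≤2 M maximal)) (maximal-matching-size odd α≤2 M′ maximal′)))

  claw-free : IndependenceAtMost 2 → ClawFree G
  claw-free α≤2 _ a b d _ _ _ a≢b a≢d b≢d (a≁b , a≁d , b≁d)
    with α≤2 (a ∷ b ∷ d ∷ [])
             ( ((a≢b ∷ a≢d ∷ []) ∷ (b≢d ∷ []) ∷ [] ∷ [])
             , ((a≁b ∷ a≁d ∷ []) ∷ (b≁d ∷ []) ∷ [] ∷ []))
  ... | s≤s (s≤s ())

lemma3 : (n : ℕ) → (G : Graph n) → n % 2 ≡ 1 → IndependenceNumber G 2 →
    Equimatchable G × ClawFree G
lemma3 n G odd α = equimatchable G odd (proj₂ α) , claw-free G (proj₂ α)
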